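{- Let $p>2$ be a prime. For integers $n,k\ge1$ define finite sequences $\beta_n^k$ of length $2^n$ inductively by $\beta_1^k=\left[\frac1{p^k},\frac1{p^k}\right]$ and, if $\beta_n^k=[b_0,\dots,b_{2^n-1}]$, $$\beta_{n+1}^k=\left[b_0,\frac1{p^k},-b_1,-\frac1{p^k},b_2,\frac1{p^k},\dots,(-1)^ib_i,\frac{(-1)^i}{p^k},\dots,b_{2^n-1},-\frac1{p^k}\right]$$ (the term $b_i$ is replaced by the pair $(-1)^ib_i,\ (-1)^i/p^k$ for $i=0,\dots,2^n-1$). Then for every $n,k\ge1$, $\beta_n^k$ is a nice finite Browkin continued fraction, and $\tilde B_{2^n-1}(\beta_n^k)=1$.
   Context: Let $\mathcal{Y}=\mathbb{Z}[1/p]\cap(-p/2,p/2)$. A finite Browkin continued fraction $[a_0,\dots,a_{t-1}]$ is a sequence in $\mathcal{Y}$ with $|a_i|_p>1$ for $i\ge1$; its convergent sequences are $A_{ -1}=1$, $A_0=a_0$, $B_{ -1}=0$, $B_0=1$, $A_n=a_nA_{n-1}+A_{n-2}$, $B_n=a_nB_{n-1}+B_{n-2}$; $B_r(\beta)$ denotes $B_r$ computed for the sequence $\beta$. For nonzero $x\in\mathbb{Z}[1/p]$, $\tilde x=x\,p^{ -v_p(x)}$ is its prime-to-$p$ part. The finite BCF is nice if: (a) $|a_0|_p>1$ and $|a_0|_\infty<\frac p4$; (b) $\left|\frac{A_{t-1}}{A_{t-2}}\right|_\infty>\frac4p$; (c) there exists an integer $q$ with $\tilde B_{t-1}\mid q\mid\tilde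 B_{t-1}^2$ whose class modulo $\tilde A_{t-1}^2$ belongs to the multiplicative subgroup generated by the class of $p$. -}

module Defs where

open import Data.Nat as ℕ using (ℕ; zero; suc; NonZero)
open import Data.Nat.Properties using (m^n≢0)
open import Data.Nat.Divisibility as ℕD using ()
open import Data.Integer as ℤ using (ℤ; +_; -[1+_])
open import Data.Integer.Divisibility as ℤD using ()
open import Data.Rational as ℚ using (ℚ; _/_; 0ℚ; 1ℚ; ∣_∣)
open import Data.List using (List; []; _∷_; length)
open import Data.Bool using (Bool; true; false; not)
open import Data.Product using (Σ; ∃; _×_; _,_; proj₁; proj₂)
open import Relation.Binary.PropositionalEquality using (_≡_; _≢_)
open import Relation.Nullary using (¬_)

ℤ→ℚ : ℤ → ℚ
ℤ→ℚ z = z / 1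

ℕ→ℚ : ℕ → ℚ
ℕ→ℚ n = (+ n) / 1

-- 1 / p^k as a rational (junk value 0 for p = 0, which never occurs since p is prime)
invPow : ℕ → ℕ → ℚ
invPow zero    k = 0ℚ
invPow (suc m) k = (+ 1 / (suc m ℕ.^ k)) {{m^n≢0 (suc m) k}}

zpow : ℕ → ℤ → ℚ
zpow p (+ n)     = ℕ→ℚ (p ℕ.^ n)
zpow p -[1+ n ]  = invPow p (suc n)

-- x ∈ ℤ[1/p]: in lowest terms, the denominator of x is a power of p
InZ1p : ℕ → ℚ → Set
InZ1p p x = ∃ λ (e : ℕ) → ℚ.denominatorℕ x ≡ p ℕ.^ e

InY : ℕ → ℚ → Set
InY p x = InZ1p p x × (ℚ.- (ℕ→ℚ p ℚ.* (+ 1 / 2)) ℚ.< x) × (x ℚ.< ℕ→ℚ p ℚ.* (+ 1 / 2))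

-- |x|_p > 1, i.e. v_p(x) < 0, i.e. p divides the (reduced) denominator of x
PAbsGt1 : ℕ → ℚ → Set
PAbsGt1 p x = p ℕD.∣ ℚ.denominatorℕ x

-- m = x̃ = x p^{-v_p(x)}: the prime-to-p part of a nonzero x ∈ ℤ[1/p].
-- Equivalently m is an integer not divisible by p with x = m p^j for some j ∈ ℤ
-- (j = v_p(x)); note this forces x ≠ 0.
IsTilde : ℕ → ℚ → ℤ → Set
IsTilde p x m = (¬ ((+ p) ℤD.∣ m)) × (∃ λ (j : ℤ) → x ≡ ℤ→ℚ m ℚ.* zpow p j)

-- Convergents.  State (X_{n-1}, X_n) is advanced by a_{n+1}:
-- (X_{n-1}, X_n) ↦ (X_n, a_{n+1} X_n + X_{n-1}).
step : ℚ → ℚ × ℚ → ℚ × ℚ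
step a (x₋ , x) = (x , a ℚ.* x ℚ.+ x₋)

run : List ℚ → ℚ × ℚ → ℚ × ℚ
run []       s = s
run (a ∷ as) s = run as (step a s)

-- For [a_0, …, a_{t-1}] (t ≥ 1): (A_{t-2}, A_{t-1}), starting from A_{-1} = 1, A_0 = a_0.
lastA : List ℚ → ℚ × ℚ
lastA []        = (1ℚ , 0ℚ)   -- junk, empty sequences are never BCFs below
lastA (a₀ ∷ as) = run as (1ℚ , a₀)

-- (B_{t-2}, B_{t-1}), starting from B_{-1} = 0, B_0 = 1.
lastB : List ℚ → ℚ × ℚ
lastB []        = (0ℚ , 1ℚ)
lastB (a₀ ∷ as) = run as (0ℚ , 1ℚ)

data AllQ (P : ℚ → Set) : List ℚ → Set where
  []  : AllQ P []
  _∷_ : ∀ {x xs} → P x → AllQ P xs → AllQ P (x ∷ xs)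

IsFiniteBCF : ℕ → List ℚ → Set
IsFiniteBCF p []        = Data.Empty.⊥
  where import Data.Empty
IsFiniteBCF p (a₀ ∷ as) = InY p a₀ × AllQ (λ a → InY p a × PAbsGt1 p a) as

CondA : ℕ → List ℚ → Set
CondA p []       = Data.Empty.⊥
  where import Data.Empty
CondA p (a₀ ∷ _) = PAbsGt1 p a₀ × (∣ a₀ ∣ ℚ.< ℕ→ℚ p ℚ.* (+ 1 / 4))

-- Condition (b): |A_{t-1} / A_{t-2}|_∞ > 4/p (the quotient must be defined, A_{t-2} ≠ 0;
-- with A_{t-2} ≠ 0 the inequality is cleared of denominators: 4 |A_{t-2}| < p |A_{t-1}|).
CondB : ℕ → List ℚ → Set
CondB p as = (proj₁ (lastA as) ≢ 0ℚ)
           × (ℕ→ℚ 4 ℚ.* ∣ proj₁ (lastA as) ∣ ℚ.< ℕ→ℚ p ℚ.* ∣ proj₂ (lastA as) ∣)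

-- Condition (c): there is an integer q with B̃_{t-1} ∣ q ∣ B̃_{t-1}^2 whose class modulo
-- Ã_{t-1}^2 lies in the subgroup generated by the class of p, i.e. q ≡ p^e (mod Ã_{t-1}^2)
-- for some e ∈ ℕ (p is a unit mod Ã_{t-1}^2, so the cyclic subgroup is {p^e : e ∈ ℕ}).
CondC : ℕ → List ℚ → Set
CondC p as =
  Σ ℤ λ Ã → Σ ℤ λ B̃ → IsTilde p (proj₂ (lastA as)) Ã × IsTilde p (proj₂ (lastB as)) B̃ ×
    (Σ ℤ λ q → (B̃ ℤD.∣ q) × (q ℤD.∣ (B̃ ℤ.* B̃)) ×
       (∃ λ (e : ℕ) → (Ã ℤ.* Ã) ℤD.∣ (q ℤ.- (+ (p ℕ.^ e)))))

IsNiceBCF : ℕ → List ℚ → Set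
IsNiceBCF p as = IsFiniteBCF p as × CondA p as × CondB p as × CondC p as

sgn : Bool → ℚ → ℚ
sgn true  x = x
sgn false x = ℚ.- x

expand : ℕ → ℕ → Bool → List ℚ → List ℚ
expand p k s []       = []
expand p k s (b ∷ bs) = sgn s b ∷ sgn s (invPow p k) ∷ expand p k (not s) bs

-- β p n k = β_n^k (defined for n ≥ 1; β p 0 k = [] is junk)
β : ℕ → ℕ → ℕ → List ℚ
β p zero                k = []
β p (suc zero)          k = invPow p k ∷ invPow p k ∷ []
β p (suc (suc n))       k = expand p k true (β p (suc n) k)

-- Write x = p^(-k). The sequence β_(n+1)^k arises from β_n^(2k) = x β_n^k by
-- replacing each b_i by (-1)^i b_i, (-1)^i x, and the substitution
-- (u, v) ↦ (v + x u, v) on pairs of consecutive convergents turns a block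
-- [a₀, x, -a₁, -x] into the two terms [a₀ x, a₁ x]. Hence the last convergents
-- A = A_(t-1), A₋ = A_(t-2), B, B₋ of β_(n+1)^k are determined by those of
-- β_n^(2k): A = A′ + B′, B = x B′, B₋ = B₋′ - B′, x A₋ = A₋′ + B₋′ - A′ - B′.
-- Induction on n gives B = p^(-e) and A = N p^(-e-k) with N ≡ 1 (mod p), so
-- B̃ = 1 and condition (c) holds with q = 1. It also propagates, while
-- 5x² ≤ 1, the estimates 0 < B ≤ x, 0 < A - B₋ ≤ 3x², A₋ ≤ B ≤ A₋ + 5x³,
-- A ≥ 1 and A₋ ≠ 0, which give |A₋| ≤ x ≤ 1/3 and hence condition (b).
-- All terms are ±p^(-k), which gives condition (a) and membership in 𝒴.

module Submission where

open import Defs hiding ([]; _∷_)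
open import Data.Bool using (true; false; not)
open import Data.Empty using (⊥-elim)
open import Data.Integer as ℤ using (+_; -[1+_])
import Data.Integer.Properties as ℤₚ
open import Data.List using (List; []; _∷_; map)
open import Data.Nat as ℕ using (ℕ; zero; suc; NonZero; s≤s; z≤n; _≤_; _>_)
import Data.Nat.Coprimality as Coprimality
open import Data.Nat.Divisibility using (_∣_; ∣m+n∣m⇒∣n; m∣m*n; ∣1⇒≡1; ∣-refl; _∣0)
open import Data.Nat.Primality using (Prime)
import Data.Nat.Properties as ℕₚ
open import Data.Product using (_×_; _,_; proj₁; proj₂)
open import Data.Rational as ℚ using (ℚ; mkℚ; _/_; _+_; _*_; -_; _-_; 0ℚ; 1ℚ; ∣_∣)
import Data.Rational.Properties as ℚₚ
open import Data.Sum using (_⊎_; inj₁; inj₂)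
open import Data.Unit using (tt)
open import Level using (0ℓ)
open import Relation.Binary.PropositionalEquality
open import Relation.Nullary using (¬_)
open import Relation.Nullary.Decidable using (dec⇒maybe; toWitness)
open import Tactic.RingSolver using (solve; solve-∀)
open import Tactic.RingSolver.Core.AlmostCommutativeRing using (AlmostCommutativeRing; fromCommutativeRing)

ℚ-ring : AlmostCommutativeRing 0ℓ 0ℓ
ℚ-ring = fromCommutativeRing ℚₚ.+-*-commutativeRing (λ x → dec⇒maybe (0ℚ ℚₚ.≟ x))

ℕ→ℚ≡mkℚ : ∀ n → ℕ→ℚ n ≡ mkℚ (+ n) 0 (Coprimality.sym (Coprimality.1-coprimeTo n))
ℕ→ℚ≡mkℚ n = ℚₚ.normalize-coprime _

ℕ→ℚ-+ : ∀ m n → ℕ→ℚ (m ℕ.+ n) ≡ ℕ→ℚ m + ℕ→ℚ n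
ℕ→ℚ-+ m n rewrite ℕ→ℚ≡mkℚ m | ℕ→ℚ≡mkℚ n =
  ℚₚ./-cong (trans (ℤₚ.pos-+ m n) (sym (cong₂ ℤ._+_ (ℤₚ.*-identityʳ (+ m)) (ℤₚ.*-identityʳ (+ n))))) refl

ℕ→ℚ-* : ∀ m n → ℕ→ℚ (m ℕ.* n) ≡ ℕ→ℚ m * ℕ→ℚ n
ℕ→ℚ-* m n rewrite ℕ→ℚ≡mkℚ m | ℕ→ℚ≡mkℚ n = ℚₚ./-cong (ℤₚ.pos-* m n) refl

ℕ→ℚ-mono-≤ : ∀ {m n} → m ≤ n → ℕ→ℚ m ℚ.≤ ℕ→ℚ n
ℕ→ℚ-mono-≤ {m} {n} m≤n rewrite ℕ→ℚ≡mkℚ m | ℕ→ℚ≡mkℚ n =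
  ℚ.*≤* (subst₂ ℤ._≤_ (sym (ℤₚ.*-identityʳ (+ m))) (sym (ℤₚ.*-identityʳ (+ n))) (ℤ.+≤+ m≤n))

1/n*n≡1 : ∀ n .{{_ : NonZero n}} → (+ 1 / n) * ℕ→ℚ n ≡ 1ℚ
1/n*n≡1 (suc n) rewrite ℚₚ.normalize-coprime (Coprimality.1-coprimeTo (suc n)) | ℕ→ℚ≡mkℚ (suc n) =
  ℚₚ.*-inverseˡ (mkℚ (+ suc n) 0 (Coprimality.sym (Coprimality.1-coprimeTo (suc n))))

denominator-1/n : ∀ n .{{_ : NonZero n}} → ℚ.denominatorℕ (+ 1 / n) ≡ n
denominator-1/n (suc n) rewrite ℚₚ.normalize-coprime (Coprimality.1-coprimeTo (suc n)) = refl

invPow-*-pow : ∀ p k .{{_ : NonZero p}} → invPow p k * ℕ→ℚ (p ℕ.^ k) ≡ 1ℚ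
invPow-*-pow (suc m) k = 1/n*n≡1 (suc m ℕ.^ k) {{ℕₚ.m^n≢0 (suc m) k}}

*-inverse-unique : ∀ {a b c} → a * c ≡ 1ℚ → b * c ≡ 1ℚ → a ≡ b
*-inverse-unique {a} {b} {c} ac≡1 bc≡1 = begin
  a            ≡⟨ ℚₚ.*-identityʳ a ⟨
  a * 1ℚ       ≡⟨ cong (a *_) bc≡1 ⟨
  a * (b * c)  ≡⟨ solve (a ∷ b ∷ c ∷ []) ℚ-ring ⟩
  b * (a * c)  ≡⟨ cong (b *_) ac≡1 ⟩
  b * 1ℚ       ≡⟨ ℚₚ.*-identityʳ b ⟩
  b            ∎
  where open ≡-Reasoning

invPow-+ : ∀ p j k .{{_ : NonZero p}} → invPow p (j ℕ.+ k) ≡ invPow p j * invPow p k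
invPow-+ p j k = *-inverse-unique (invPow-*-pow p (j ℕ.+ k)) (begin
  (x * y) * ℕ→ℚ (p ℕ.^ (j ℕ.+ k))  ≡⟨ cong (λ n → (x * y) * ℕ→ℚ n) (ℕₚ.^-distribˡ-+-* p j k) ⟩
  (x * y) * ℕ→ℚ (p ℕ.^ j ℕ.* p ℕ.^ k)  ≡⟨ cong ((x * y) *_) (ℕ→ℚ-* (p ℕ.^ j) (p ℕ.^ k)) ⟩
  (x * y) * (P * Q)  ≡⟨ interchange x y P Q ⟩
  (x * P) * (y * Q)  ≡⟨ cong₂ _*_ (invPow-*-pow p j) (invPow-*-pow p k) ⟩
  1ℚ * 1ℚ            ≡⟨ ℚₚ.*-identityˡ 1ℚ ⟩
  1ℚ                 ∎)
  where
  open ≡-Reasoning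
  x = invPow p j; y = invPow p k
  P = ℕ→ℚ (p ℕ.^ j); Q = ℕ→ℚ (p ℕ.^ k)
  interchange : ∀ a b c d → (a * b) * (c * d) ≡ (a * c) * (b * d)
  interchange = solve-∀ ℚ-ring

invPow-pos : ∀ p k .{{_ : NonZero p}} → 0ℚ ℚ.< invPow p k
invPow-pos (suc m) k = ℚₚ.positive⁻¹ _ {{ℚₚ.normalize-pos 1 (suc m ℕ.^ k) {{ℕₚ.m^n≢0 (suc m) k}}}}

invPow-denominator : ∀ p k .{{_ : NonZero p}} → ℚ.denominatorℕ (invPow p k) ≡ p ℕ.^ k
invPow-denominator (suc m) k = denominator-1/n (suc m ℕ.^ k) {{ℕₚ.m^n≢0 (suc m) k}}

invPow-shift : ∀ p e j .{{_ : NonZero p}} → invPow p e ≡ ℕ→ℚ (p ℕ.^ j) * invPow p (e ℕ.+ j)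
invPow-shift p e j = begin
  y                  ≡⟨ ℚₚ.*-identityʳ y ⟨
  y * 1ℚ             ≡⟨ cong (y *_) (invPow-*-pow p j) ⟨
  y * (z * P)        ≡⟨ rearrange y z P ⟩
  P * (y * z)        ≡⟨ cong (P *_) (invPow-+ p e j) ⟨
  P * invPow p (e ℕ.+ j) ∎
  where
  open ≡-Reasoning
  y = invPow p e; z = invPow p j; P = ℕ→ℚ (p ℕ.^ j)
  rearrange : ∀ y z P → y * (z * P) ≡ P * (y * z)
  rearrange = solve-∀ ℚ-ring

ℕ→ℚ-nonNeg : ∀ n → 0ℚ ℚ.≤ ℕ→ℚ n
ℕ→ℚ-nonNeg n = ℕ→ℚ-mono-≤ {0} {n} z≤n

*-pos : ∀ {a b} → 0ℚ ℚ.< a → 0ℚ ℚ.< b → 0ℚ ℚ.< a * b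
*-pos {a} {b} a>0 b>0 = ℚₚ.positive⁻¹ _ {{ℚₚ.pos*pos⇒pos a {{ℚ.positive a>0}} b {{ℚ.positive b>0}}}}

*-nonNeg : ∀ {a b} → 0ℚ ℚ.≤ a → 0ℚ ℚ.≤ b → 0ℚ ℚ.≤ a * b
*-nonNeg {a} {b} a≥0 b≥0 =
  ℚₚ.nonNegative⁻¹ _ {{ℚₚ.nonNeg*nonNeg⇒nonNeg a {{ℚ.nonNegative a≥0}} b {{ℚ.nonNegative b≥0}}}}

p≤p+q : ∀ {p q} → 0ℚ ℚ.≤ q → p ℚ.≤ p + q
p≤p+q {p} {q} q≥0 = subst (ℚ._≤ p + q) (ℚₚ.+-identityʳ p) (ℚₚ.+-monoʳ-≤ p q≥0)

p<p+q : ∀ {p q} → 0ℚ ℚ.< q → p ℚ.< p + q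
p<p+q {p} {q} q>0 = subst (ℚ._< p + q) (ℚₚ.+-identityʳ p) (ℚₚ.+-monoʳ-< p q>0)

p-q≤p : ∀ {p q} → 0ℚ ℚ.≤ q → p - q ℚ.≤ p
p-q≤p {p} {q} q≥0 = subst (p - q ℚ.≤_) (ℚₚ.+-identityʳ p) (ℚₚ.+-monoʳ-≤ p (ℚₚ.neg-antimono-≤ q≥0))

p≤n*p : ∀ n {p} → 1 ≤ n → 0ℚ ℚ.≤ p → p ℚ.≤ ℕ→ℚ n * p
p≤n*p n {p} 1≤n p≥0 =
  subst (ℚ._≤ ℕ→ℚ n * p) (ℚₚ.*-identityˡ p) (ℚₚ.*-monoʳ-≤-nonNeg p {{ℚ.nonNegative p≥0}} (ℕ→ℚ-mono-≤ 1≤n))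

p*q≤p : ∀ {p q} → 0ℚ ℚ.≤ p → q ℚ.≤ 1ℚ → p * q ℚ.≤ p
p*q≤p {p} {q} p≥0 q≤1 =
  subst (p * q ℚ.≤_) (ℚₚ.*-identityʳ p) (ℚₚ.*-monoˡ-≤-nonNeg p {{ℚ.nonNegative p≥0}} q≤1)

p<q⇒p-q<0 : ∀ {p q} → p ℚ.< q → p - q ℚ.< 0ℚ
p<q⇒p-q<0 {p} {q} p<q = subst (p - q ℚ.<_) (ℚₚ.+-inverseʳ q) (ℚₚ.+-monoˡ-< (- q) p<q)

*-cancelˡ-≡-pos : ∀ {x p q} → 0ℚ ℚ.< x → x * p ≡ x * q → p ≡ q
*-cancelˡ-≡-pos {x} x>0 xp≡xq =
  ℚₚ.≤-antisym (cancel (ℚₚ.≤-reflexive xp≡xq)) (cancel (ℚₚ.≤-reflexive (sym xp≡xq)))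
  where
  cancel : ∀ {p q} → x * p ℚ.≤ x * q → p ℚ.≤ q
  cancel = ℚₚ.*-cancelˡ-≤-pos x {{ℚ.positive x>0}}

-- Starting one step earlier, from (A_(-2), A_(-1)) = (0, 1) and (B_(-2), B_(-1)) = (1, 0),
-- lets the recurrences run over the whole sequence.
convA convB : List ℚ → ℚ × ℚ
convA as = run as (0ℚ , 1ℚ)
convB as = run as (1ℚ , 0ℚ)

lastA≡convA : ∀ a as → lastA (a ∷ as) ≡ convA (a ∷ as)
lastA≡convA a as = cong (λ t → run as (1ℚ , t)) a≡a*1+0
  where
  a≡a*1+0 : a ≡ a * 1ℚ + 0ℚ
  a≡a*1+0 = solve (a ∷ []) ℚ-ring

lastB≡convB : ∀ a as → lastB (a ∷ as) ≡ convB (a ∷ as)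
lastB≡convB a as = cong (λ t → run as (0ℚ , t)) 1≡a*0+1
  where
  1≡a*0+1 : 1ℚ ≡ a * 0ℚ + 1ℚ
  1≡a*0+1 = solve (a ∷ []) ℚ-ring

run-linear : ∀ as u v → run as (u , v) ≡
  (u * proj₁ (convB as) + v * proj₁ (convA as) , u * proj₂ (convB as) + v * proj₂ (convA as))
run-linear [] u v = cong₂ _,_ (solve (u ∷ v ∷ []) ℚ-ring) (solve (u ∷ v ∷ []) ℚ-ring)
run-linear (a ∷ as) u v
  rewrite run-linear as v (a * v + u) | run-linear as 0ℚ (a * 0ℚ + 1ℚ) | run-linear as 1ℚ (a * 1ℚ + 0ℚ)
  = cong₂ _,_ (regroup _ _) (regroup _ _)
  where
  regroup : ∀ b α → v * b + (a * v + u) * α ≡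
    u * (0ℚ * b + (a * 0ℚ + 1ℚ) * α) + v * (1ℚ * b + (a * 1ℚ + 0ℚ) * α)
  regroup b α = solve (a ∷ u ∷ v ∷ b ∷ α ∷ []) ℚ-ring

twist : ℚ → ℚ × ℚ → ℚ × ℚ
twist x (u , v) = (v + x * u , v)

twist-block : ∀ x a₀ a₁ s →
  twist x (run (a₀ ∷ x ∷ - a₁ ∷ - x ∷ []) s) ≡ run (a₀ * x ∷ a₁ * x ∷ []) (twist x s)
twist-block x a₀ a₁ (u , v) = cong₂ _,_ first second
  where
  first : let w = a₀ * v + u; w′ = - a₁ * (x * w + v) + w in
    - x * w′ + (x * w + v) + x * w′ ≡ a₀ * x * v + (v + x * u)
  first = solve (x ∷ a₀ ∷ a₁ ∷ u ∷ v ∷ []) ℚ-ring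
  second : let w = a₀ * v + u; w′ = - a₁ * (x * w + v) + w in
    - x * w′ + (x * w + v) ≡ a₁ * x * (a₀ * x * v + (v + x * u)) + v
  second = solve (x ∷ a₀ ∷ a₁ ∷ u ∷ v ∷ []) ℚ-ring

data Even {A : Set} : List A → Set where
  []    : Even []
  cons₂ : ∀ {a b as} → Even as → Even (a ∷ b ∷ as)

twist-run-expand : ∀ p k {as} → Even as → ∀ s →
  twist (invPow p k) (run (expand p k true as) s) ≡ run (map (_* invPow p k) as) (twist (invPow p k) s)
twist-run-expand p k [] s = refl
twist-run-expand p k (cons₂ {a₀} {a₁} {as} even) s =
  trans (twist-run-expand p k even _) (cong (run (map (_* invPow p k) as)) (twist-block (invPow p k) a₀ a₁ s))

expand-even : ∀ p k s as → Even (expand p k s as)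
expand-even p k s []       = []
expand-even p k s (a ∷ as) = cons₂ (expand-even p k (not s) as)

β-even : ∀ p n k → Even (β p (suc n) k)
β-even p zero    k = cons₂ []
β-even p (suc n) k = expand-even p k true (β p (suc n) k)

sgn-* : ∀ s a y → sgn s a * y ≡ sgn s (a * y)
sgn-* true  a y = refl
sgn-* false a y = sym (ℚₚ.neg-distribˡ-* a y)

expand-scale : ∀ p k s as .{{_ : NonZero p}} →
  map (_* invPow p k) (expand p k s as) ≡ expand p (k ℕ.+ k) s (map (_* invPow p k) as)
expand-scale p k s []       = refl
expand-scale p k s (a ∷ as) = cong₂ _∷_ (sgn-* s a _)
  (cong₂ _∷_ (trans (sgn-* s _ _) (cong (sgn s) (sym (invPow-+ p k k)))) (expand-scale p k (not s) as))

β-scale : ∀ p n k .{{_ : NonZero p}} → map (_* invPow p k) (β p n k) ≡ β p n (k ℕ.+ k)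
β-scale p zero          k = refl
β-scale p (suc zero)    k = cong₂ _∷_ x*x≡x² (cong₂ _∷_ x*x≡x² refl)
  where x*x≡x² = sym (invPow-+ p k k)
β-scale p (suc (suc n)) k =
  trans (expand-scale p k true _) (cong (expand p (k ℕ.+ k) true) (β-scale p (suc n) k))

-- (A_(t-2), A_(t-1), B_(t-2), B_(t-1)) for a sequence of length t.
record Convergents : Set where
  constructor ⟨_,_,_,_⟩
  field
    A₋ A B₋ B : ℚ

convergents : List ℚ → Convergents
convergents as = ⟨ proj₁ (convA as) , proj₂ (convA as) , proj₁ (convB as) , proj₂ (convB as) ⟩

record Doubling (x : ℚ) (C C′ : Convergents) : Set where
  open Convergents C
  open Convergents C′ renaming (A₋ to A₋′; A to A′; B₋ to B₋′; B to B′)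
  field
    A≡   : A ≡ A′ + B′
    B≡   : B ≡ x * B′
    B₋≡  : B₋ ≡ B₋′ - B′
    xA₋≡ : x * A₋ ≡ (A₋′ + B₋′) - (A′ + B′)

β-doubling : ∀ p n k .{{_ : NonZero p}} →
  Doubling (invPow p k) (convergents (β p (suc (suc n)) k)) (convergents (β p (suc n) (k ℕ.+ k)))
β-doubling p n k = record
  { A≡   = A≡
  ; B≡   = B≡
  ; B₋≡  = *-cancelˡ-≡-pos (invPow-pos p k) (begin
      x * B₋            ≡⟨ isolate B (x * B₋) ⟩
      (B + x * B₋) - B  ≡⟨ cong₂ _-_ B+xB₋≡ B≡ ⟩
      x * B₋′ - x * B′  ≡⟨ factor x B₋′ B′ ⟩
      x * (B₋′ - B′)    ∎)
  ; xA₋≡ = begin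
      x * A₋            ≡⟨ isolate A (x * A₋) ⟩
      (A + x * A₋) - A  ≡⟨ cong₂ _-_ A+xA₋≡ A≡ ⟩
      (A₋′ + B₋′) - (A′ + B′) ∎
  }
  where
  open ≡-Reasoning
  x = invPow p k
  L  = β p (suc (suc n)) k
  L′ = β p (suc n) (k ℕ.+ k)
  open Convergents (convergents L)
  open Convergents (convergents L′) renaming (A₋ to A₋′; A to A′; B₋ to B₋′; B to B′)
  twist-run-β : ∀ s → twist x (run L s) ≡ run L′ (twist x s)
  twist-run-β s = trans (twist-run-expand p k (β-even p n k) s) (cong (λ as → run as (twist x s)) (β-scale p (suc n) k))
  twistA : twist x (convA L) ≡ _
  twistA = trans (twist-run-β (0ℚ , 1ℚ)) (run-linear L′ _ _)
  twistB : twist x (convB L) ≡ _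
  twistB = trans (twist-run-β (1ℚ , 0ℚ)) (run-linear L′ _ _)
  simplify₁ : ∀ x b a → (1ℚ + x * 0ℚ) * b + 1ℚ * a ≡ a + b
  simplify₁ = solve-∀ ℚ-ring
  simplify₀ : ∀ x b a → (0ℚ + x * 1ℚ) * b + 0ℚ * a ≡ x * b
  simplify₀ = solve-∀ ℚ-ring
  isolate : ∀ a b → b ≡ (a + b) - a
  isolate = solve-∀ ℚ-ring
  factor : ∀ x a b → x * a - x * b ≡ x * (a - b)
  factor = solve-∀ ℚ-ring
  A≡ : A ≡ A′ + B′
  A≡ = trans (cong proj₂ twistA) (simplify₁ x B′ A′)
  B≡ : B ≡ x * B′
  B≡ = trans (cong proj₂ twistB) (simplify₀ x B′ A′)
  A+xA₋≡ : A + x * A₋ ≡ A₋′ + B₋′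
  A+xA₋≡ = trans (cong proj₁ twistA) (simplify₁ x B₋′ A₋′)
  B+xB₋≡ : B + x * B₋ ≡ x * B₋′
  B+xB₋≡ = trans (cong proj₁ twistB) (simplify₀ x B₋′ A₋′)

⟨⟩-cong : ∀ {a b c d a′ b′ c′ d′} → a ≡ a′ → b ≡ b′ → c ≡ c′ → d ≡ d′ →
  ⟨ a , b , c , d ⟩ ≡ ⟨ a′ , b′ , c′ , d′ ⟩
⟨⟩-cong refl refl refl refl = refl

convergents-pair : ∀ x → convergents (x ∷ x ∷ []) ≡ ⟨ x , 1ℚ + x * x , 1ℚ , x ⟩
convergents-pair x = ⟨⟩-cong A₋≡x A≡1+x² B₋≡1 B≡x
  where
  A₋≡x : x * 1ℚ + 0ℚ ≡ x
  A₋≡x = solve (x ∷ []) ℚ-ring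
  A≡1+x² : x * (x * 1ℚ + 0ℚ) + 1ℚ ≡ 1ℚ + x * x
  A≡1+x² = solve (x ∷ []) ℚ-ring
  B₋≡1 : x * 0ℚ + 1ℚ ≡ 1ℚ
  B₋≡1 = solve (x ∷ []) ℚ-ring
  B≡x : x * (x * 0ℚ + 1ℚ) + 0ℚ ≡ x
  B≡x = solve (x ∷ []) ℚ-ring

record Bounds (x : ℚ) (C : Convergents) : Set where
  open Convergents C
  field
    B>0      : 0ℚ ℚ.< B
    B≤x      : B ℚ.≤ x
    B₋<A     : B₋ ℚ.< A
    A-B₋≤3x² : A - B₋ ℚ.≤ ℕ→ℚ 3 * (x * x)
    A₋≤B     : A₋ ℚ.≤ B
    B-A₋≤5x³ : B - A₋ ℚ.≤ ℕ→ℚ 5 * (x * (x * x))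
    1≤A      : 1ℚ ℚ.≤ A
    A₋≢0     : A₋ ≢ 0ℚ

bounds-base : ∀ {x} → 0ℚ ℚ.< x → Bounds x ⟨ x , 1ℚ + x * x , 1ℚ , x ⟩
bounds-base {x} x>0 = record
  { B>0      = x>0
  ; B≤x      = ℚₚ.≤-refl
  ; B₋<A     = p<p+q x²>0
  ; A-B₋≤3x² = begin
      1ℚ + x * x - 1ℚ  ≡⟨ solve (x ∷ []) ℚ-ring ⟩
      x * x            ≤⟨ p≤n*p 3 (s≤s z≤n) (ℚₚ.<⇒≤ x²>0) ⟩
      ℕ→ℚ 3 * (x * x)  ∎
  ; A₋≤B     = ℚₚ.≤-refl
  ; B-A₋≤5x³ = begin
      x - x                       ≡⟨ solve (x ∷ []) ℚ-ring ⟩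
      0ℚ                          ≤⟨ *-nonNeg (ℕ→ℚ-nonNeg 5) (ℚₚ.<⇒≤ (*-pos x>0 x²>0)) ⟩
      ℕ→ℚ 5 * (x * (x * x))       ∎
  ; 1≤A      = p≤p+q (ℚₚ.<⇒≤ x²>0)
  ; A₋≢0     = ≢-sym (ℚₚ.<⇒≢ x>0)
  }
  where
  open ℚₚ.≤-Reasoning
  x²>0 : 0ℚ ℚ.< x * x
  x²>0 = *-pos x>0 x>0

module _ {x : ℚ} (x≥0 : 0ℚ ℚ.≤ x) (5x²≤1 : ℕ→ℚ 5 * (x * x) ℚ.≤ 1ℚ) where
  private
    x²≥0 : 0ℚ ℚ.≤ x * x
    x²≥0 = *-nonNeg x≥0 x≥0

  x²≤1 : x * x ℚ.≤ 1ℚ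
  x²≤1 = ℚₚ.≤-trans (p≤n*p 5 (s≤s z≤n) x²≥0) 5x²≤1

  5x³≤x : ℕ→ℚ 5 * (x * (x * x)) ℚ.≤ x
  5x³≤x = begin
    ℕ→ℚ 5 * (x * (x * x))  ≡⟨ solve (x ∷ []) ℚ-ring ⟩
    x * (ℕ→ℚ 5 * (x * x))  ≤⟨ p*q≤p x≥0 5x²≤1 ⟩
    x                      ∎
    where open ℚₚ.≤-Reasoning

  3x⁴≤x² : ℕ→ℚ 3 * (x * x * (x * x)) ℚ.≤ x * x
  3x⁴≤x² = begin
    ℕ→ℚ 3 * (x * x * (x * x))  ≡⟨ solve (x ∷ []) ℚ-ring ⟩
    x * x * (ℕ→ℚ 3 * (x * x))  ≤⟨ p*q≤p x²≥0 (ℚₚ.≤-trans 3x²≤5x² 5x²≤1) ⟩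
    x * x                      ∎
    where
    open ℚₚ.≤-Reasoning
    3x²≤5x² : ℕ→ℚ 3 * (x * x) ℚ.≤ ℕ→ℚ 5 * (x * x)
    3x²≤5x² = ℚₚ.*-monoʳ-≤-nonNeg (x * x) {{ℚ.nonNegative x²≥0}} (ℕ→ℚ-mono-≤ {3} {5} (s≤s (s≤s (s≤s z≤n))))

  5x⁶≤x⁴ : ℕ→ℚ 5 * (x * x * (x * x * (x * x))) ℚ.≤ x * x * (x * x)
  5x⁶≤x⁴ = begin
    ℕ→ℚ 5 * (x * x * (x * x * (x * x)))  ≡⟨ solve (x ∷ []) ℚ-ring ⟩
    x * x * (x * x) * (ℕ→ℚ 5 * (x * x))  ≤⟨ p*q≤p (*-nonNeg x²≥0 x²≥0) 5x²≤1 ⟩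
    x * x * (x * x)                      ∎
    where open ℚₚ.≤-Reasoning

module BoundsStep {x A₋ A B₋ B A₋′ A′ B₋′ B′ : ℚ} (x>0 : 0ℚ ℚ.< x) (5x²≤1 : ℕ→ℚ 5 * (x * x) ℚ.≤ 1ℚ)
  (D : Doubling x ⟨ A₋ , A , B₋ , B ⟩ ⟨ A₋′ , A′ , B₋′ , B′ ⟩) (I : Bounds (x * x) ⟨ A₋′ , A′ , B₋′ , B′ ⟩) where
  open ℚₚ.≤-Reasoning
  open Doubling D
  private
    module I = Bounds I
    x≥0 : 0ℚ ℚ.≤ x
    x≥0 = ℚₚ.<⇒≤ x>0
    B′≥0 : 0ℚ ℚ.≤ B′
    B′≥0 = ℚₚ.<⇒≤ I.B>0
    instance
      _ = ℚ.nonNegative x≥0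
      _ = ℚ.nonNegative (*-nonNeg x≥0 x≥0)
      _ = ℚ.nonNegative (ℕ→ℚ-nonNeg 2)
      _ = ℚ.positive x>0

  B>0 : 0ℚ ℚ.< B
  B>0 = subst (0ℚ ℚ.<_) (sym B≡) (*-pos x>0 I.B>0)

  A₋<0 : A₋ ℚ.< 0ℚ
  A₋<0 = ℚₚ.*-cancelˡ-<-nonNeg x (begin-strict
    x * A₋                    ≡⟨ xA₋≡ ⟩
    (A₋′ + B₋′) - (A′ + B′)   <⟨ p<q⇒p-q<0 A₋′+B₋′<A′+B′ ⟩
    0ℚ                        ≡⟨ ℚₚ.*-zeroʳ x ⟨
    x * 0ℚ                    ∎)
    where
    A₋′+B₋′<A′+B′ : A₋′ + B₋′ ℚ.< A′ + B′
    A₋′+B₋′<A′+B′ = subst (A₋′ + B₋′ ℚ.<_) (ℚₚ.+-comm B′ A′) (ℚₚ.+-mono-≤-< I.A₋≤B I.B₋<A)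

  B≤x : B ℚ.≤ x
  B≤x = begin
    B            ≡⟨ B≡ ⟩
    x * B′       ≤⟨ ℚₚ.*-monoˡ-≤-nonNeg x I.B≤x ⟩
    x * (x * x)  ≤⟨ p*q≤p x≥0 (x²≤1 x≥0 5x²≤1) ⟩
    x            ∎

  B₋<A : B₋ ℚ.< A
  B₋<A = begin-strict
    B₋           ≡⟨ B₋≡ ⟩
    B₋′ - B′     ≤⟨ p-q≤p B′≥0 ⟩
    B₋′          <⟨ I.B₋<A ⟩
    A′           ≤⟨ p≤p+q B′≥0 ⟩
    A′ + B′      ≡⟨ A≡ ⟨
    A            ∎

  A-B₋≤3x² : A - B₋ ℚ.≤ ℕ→ℚ 3 * (x * x)
  A-B₋≤3x² = begin
    A - B₋                                          ≡⟨ cong₂ _-_ A≡ B₋≡ ⟩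
    (A′ + B′) - (B₋′ - B′)                          ≡⟨ solve (A′ ∷ B′ ∷ B₋′ ∷ []) ℚ-ring ⟩
    (A′ - B₋′) + ℕ→ℚ 2 * B′                         ≤⟨ ℚₚ.+-mono-≤ I.A-B₋≤3x² (ℚₚ.*-monoˡ-≤-nonNeg (ℕ→ℚ 2) I.B≤x) ⟩
    ℕ→ℚ 3 * (x * x * (x * x)) + ℕ→ℚ 2 * (x * x)     ≤⟨ ℚₚ.+-monoˡ-≤ _ (3x⁴≤x² x≥0 5x²≤1) ⟩
    x * x + ℕ→ℚ 2 * (x * x)                         ≡⟨ solve (x ∷ []) ℚ-ring ⟩
    ℕ→ℚ 3 * (x * x)                                 ∎

  B-A₋≤5x³ : B - A₋ ℚ.≤ ℕ→ℚ 5 * (x * (x * x))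
  B-A₋≤5x³ = ℚₚ.*-cancelˡ-≤-pos x (begin
    x * (B - A₋)                                    ≡⟨ solve (x ∷ B ∷ A₋ ∷ []) ℚ-ring ⟩
    x * B - x * A₋                                  ≡⟨ cong₂ _-_ (cong (x *_) B≡) xA₋≡ ⟩
    x * (x * B′) - ((A₋′ + B₋′) - (A′ + B′))        ≡⟨ solve (x ∷ A₋′ ∷ A′ ∷ B₋′ ∷ B′ ∷ []) ℚ-ring ⟩
    x * x * B′ + (B′ - A₋′) + (A′ - B₋′)
      ≤⟨ ℚₚ.+-mono-≤ (ℚₚ.+-mono-≤ (ℚₚ.*-monoˡ-≤-nonNeg (x * x) I.B≤x) I.B-A₋≤5x³) I.A-B₋≤3x² ⟩
    x * x * (x * x) + ℕ→ℚ 5 * (x * x * (x * x * (x * x))) + ℕ→ℚ 3 * (x * x * (x * x))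
      ≤⟨ ℚₚ.+-monoˡ-≤ (ℕ→ℚ 3 * (x * x * (x * x))) (ℚₚ.+-monoʳ-≤ (x * x * (x * x)) (5x⁶≤x⁴ x≥0 5x²≤1)) ⟩
    x * x * (x * x) + x * x * (x * x) + ℕ→ℚ 3 * (x * x * (x * x))
      ≡⟨ solve (x ∷ []) ℚ-ring ⟩
    x * (ℕ→ℚ 5 * (x * (x * x)))                     ∎)

  1≤A : 1ℚ ℚ.≤ A
  1≤A = ℚₚ.≤-trans I.1≤A (subst (A′ ℚ.≤_) (sym A≡) (p≤p+q B′≥0))

bounds-step : ∀ {x A₋ A B₋ B A₋′ A′ B₋′ B′} → 0ℚ ℚ.< x → ℕ→ℚ 5 * (x * x) ℚ.≤ 1ℚ →
  Doubling x ⟨ A₋ , A , B₋ , B ⟩ ⟨ A₋′ , A′ , B₋′ , B′ ⟩ →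
  Bounds (x * x) ⟨ A₋′ , A′ , B₋′ , B′ ⟩ → Bounds x ⟨ A₋ , A , B₋ , B ⟩
bounds-step x>0 5x²≤1 D I = record
  { B>0      = B>0
  ; B≤x      = B≤x
  ; B₋<A     = B₋<A
  ; A-B₋≤3x² = A-B₋≤3x²
  ; A₋≤B     = ℚₚ.<⇒≤ (ℚₚ.<-trans A₋<0 B>0)
  ; B-A₋≤5x³ = B-A₋≤5x³
  ; 1≤A      = 1≤A
  ; A₋≢0     = ℚₚ.<⇒≢ A₋<0
  }
  where open BoundsStep x>0 5x²≤1 D I

⅓ : ℚ
⅓ = + 1 / 3

x*n≡1⇒x≤⅓ : ∀ {x n} → 0ℚ ℚ.≤ x → x * ℕ→ℚ n ≡ 1ℚ → 3 ≤ n → x ℚ.≤ ⅓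
x*n≡1⇒x≤⅓ {x} {n} x≥0 xn≡1 3≤n = begin
  x                  ≡⟨ solve (x ∷ []) ℚ-ring ⟩
  ⅓ * (x * ℕ→ℚ 3)    ≤⟨ ℚₚ.*-monoˡ-≤-nonNeg ⅓ (ℚₚ.*-monoˡ-≤-nonNeg x {{ℚ.nonNegative x≥0}} (ℕ→ℚ-mono-≤ 3≤n)) ⟩
  ⅓ * (x * ℕ→ℚ n)    ≡⟨ cong (⅓ *_) xn≡1 ⟩
  ⅓ * 1ℚ             ≡⟨ ℚₚ.*-identityʳ ⅓ ⟩
  ⅓                  ∎
  where open ℚₚ.≤-Reasoning

≤⅓⇒5x²≤1 : ∀ {x} → 0ℚ ℚ.≤ x → x ℚ.≤ ⅓ → ℕ→ℚ 5 * (x * x) ℚ.≤ 1ℚ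
≤⅓⇒5x²≤1 {x} x≥0 x≤⅓ = begin
  ℕ→ℚ 5 * (x * x)    ≤⟨ ℚₚ.*-monoˡ-≤-nonNeg (ℕ→ℚ 5) (ℚₚ.*-monoˡ-≤-nonNeg x (x≤⅓)) ⟩
  ℕ→ℚ 5 * (x * ⅓)    ≤⟨ ℚₚ.*-monoˡ-≤-nonNeg (ℕ→ℚ 5) (ℚₚ.*-monoʳ-≤-nonNeg ⅓ x≤⅓) ⟩
  ℕ→ℚ 5 * (⅓ * ⅓)    ≤⟨ ℚₚ.≤ᵇ⇒≤ tt ⟩
  1ℚ                 ∎
  where
  open ℚₚ.≤-Reasoning
  instance
    _ = ℚ.nonNegative x≥0
    _ = ℚ.nonNegative (ℕ→ℚ-nonNeg 5)

∣A₋∣≤x : ∀ {x C} → 0ℚ ℚ.≤ x → ℕ→ℚ 5 * (x * x) ℚ.≤ 1ℚ → Bounds x C → ∣ Convergents.A₋ C ∣ ℚ.≤ x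
∣A₋∣≤x {x} {⟨ A₋ , A , B₋ , B ⟩} x≥0 5x²≤1 I with ℚₚ.∣p∣≡p∨∣p∣≡-p A₋
... | inj₁ ∣A₋∣≡A₋ = begin
  ∣ A₋ ∣     ≡⟨ ∣A₋∣≡A₋ ⟩
  A₋         ≤⟨ I.A₋≤B ⟩
  B          ≤⟨ I.B≤x ⟩
  x          ∎
  where open ℚₚ.≤-Reasoning; module I = Bounds I
... | inj₂ ∣A₋∣≡-A₋ = begin
  ∣ A₋ ∣                     ≡⟨ ∣A₋∣≡-A₋ ⟩
  - A₋                       ≤⟨ subst (- A₋ ℚ.≤_) (ℚₚ.+-comm (- A₋) B) (p≤p+q (ℚₚ.<⇒≤ I.B>0)) ⟩
  B - A₋                     ≤⟨ I.B-A₋≤5x³ ⟩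
  ℕ→ℚ 5 * (x * (x * x))      ≤⟨ 5x³≤x x≥0 5x²≤1 ⟩
  x                          ∎
  where open ℚₚ.≤-Reasoning; module I = Bounds I

invPow-tilde : ∀ p e N .{{_ : NonZero p}} → ¬ p ∣ N → IsTilde p (ℕ→ℚ N * invPow p e) (+ N)
invPow-tilde (suc m) zero    N p∤N = p∤N , + 0 , refl
invPow-tilde (suc m) (suc e) N p∤N = p∤N , -[1+ e ] , refl

p∤p^suc+ : ∀ {p n} k → ¬ p ∣ n → ¬ p ∣ p ℕ.^ suc k ℕ.+ n
p∤p^suc+ {p} k p∤n p∣sum = p∤n (∣m+n∣m⇒∣n p∣sum (m∣m*n (p ℕ.^ k)))

-- Gives B̃_(t-1) = 1 and Ã_(t-1) = N.
record PowerForm (p k : ℕ) (C : Convergents) : Set where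
  open Convergents C
  field
    e N : ℕ
    p∤N : ¬ p ∣ N
    B≡  : B ≡ invPow p e
    A≡  : A ≡ ℕ→ℚ N * invPow p (e ℕ.+ k)

module _ (p : ℕ) .{{_ : NonZero p}} (p∤1 : ¬ p ∣ 1) where

  powerForm-base : ∀ k → let x = invPow p (suc k) in PowerForm p (suc k) ⟨ x , 1ℚ + x * x , 1ℚ , x ⟩
  powerForm-base k = record
    { e = suc k ; N = P ℕ.+ 1 ; p∤N = p∤p^suc+ (k ℕ.+ suc k) p∤1 ; B≡ = refl
    ; A≡ = begin
        1ℚ + x * x                ≡⟨ cong₂ _+_ (invPow-*-pow p j) (invPow-+ p (suc k) (suc k)) ⟨
        y * ℕ→ℚ P + y             ≡⟨ factor y (ℕ→ℚ P) ⟩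
        (ℕ→ℚ P + 1ℚ) * y          ≡⟨ cong (_* y) (ℕ→ℚ-+ P 1) ⟨
        ℕ→ℚ (P ℕ.+ 1) * y         ∎
    }
    where
    open ≡-Reasoning
    x = invPow p (suc k); j = suc k ℕ.+ suc k; y = invPow p j; P = p ℕ.^ j
    factor : ∀ y P → y * P + y ≡ (P + 1ℚ) * y
    factor = solve-∀ ℚ-ring

  powerForm-step : ∀ k {C C′} → Doubling (invPow p (suc k)) C C′ →
    PowerForm p (suc k ℕ.+ suc k) C′ → PowerForm p (suc k) C
  powerForm-step k {C} {C′} D I = record
    { e = suc k ℕ.+ e′ ; N = P ℕ.+ N′ ; p∤N = p∤p^suc+ (k ℕ.+ suc k) p∤N′
    ; B≡ = begin
        B                         ≡⟨ D.B≡ ⟩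
        x * B′                    ≡⟨ cong (x *_) I.B≡ ⟩
        x * invPow p e′           ≡⟨ invPow-+ p (suc k) e′ ⟨
        invPow p (suc k ℕ.+ e′)   ∎
    ; A≡ = begin
        A                         ≡⟨ D.A≡ ⟩
        A′ + B′                   ≡⟨ cong₂ _+_ I.A≡ (trans I.B≡ (invPow-shift p e′ j)) ⟩
        ℕ→ℚ N′ * z + ℕ→ℚ P * z    ≡⟨ factor (ℕ→ℚ N′) (ℕ→ℚ P) z ⟩
        (ℕ→ℚ P + ℕ→ℚ N′) * z      ≡⟨ cong₂ _*_ (ℕ→ℚ-+ P N′) (cong (invPow p) (exponent e′ k)) ⟨
        ℕ→ℚ (P ℕ.+ N′) * invPow p (suc k ℕ.+ e′ ℕ.+ suc k) ∎
    }
    where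
    open ≡-Reasoning
    module D = Doubling D
    module I = PowerForm I
    open Convergents C
    open Convergents C′ renaming (A to A′; B to B′) using ()
    open PowerForm I using () renaming (e to e′; N to N′; p∤N to p∤N′)
    x = invPow p (suc k); j = suc k ℕ.+ suc k; P = p ℕ.^ j; z = invPow p (e′ ℕ.+ j)
    factor : ∀ N P z → N * z + P * z ≡ (P + N) * z
    factor = solve-∀ ℚ-ring
    exponent : ∀ e k → suc k ℕ.+ e ℕ.+ suc k ≡ e ℕ.+ (suc k ℕ.+ suc k)
    exponent e k = trans (cong (ℕ._+ suc k) (ℕₚ.+-comm (suc k) e)) (ℕₚ.+-assoc e (suc k) (suc k))

  powerForm-β : ∀ n k → PowerForm p (suc k) (convergents (β p (suc n) (suc k)))
  powerForm-β zero    k = subst (PowerForm p (suc k)) (sym (convergents-pair (invPow p (suc k)))) (powerForm-base k)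
  powerForm-β (suc n) k = powerForm-step k (β-doubling p n (suc k)) (powerForm-β n (k ℕ.+ suc k))

_≡±_ : ℚ → ℚ → Set
a ≡± x = a ≡ x ⊎ a ≡ - x

sgn-≡± : ∀ {a x} s → a ≡± x → sgn s a ≡± x
sgn-≡± true  a≡±x           = a≡±x
sgn-≡± false (inj₁ refl)    = inj₂ refl
sgn-≡± false (inj₂ refl)    = inj₁ (neg-involutive _)
  where
  neg-involutive : ∀ x → - (- x) ≡ x
  neg-involutive = solve-∀ ℚ-ring

expand-entries : ∀ p k s {as} → AllQ (_≡± invPow p k) as → AllQ (_≡± invPow p k) (expand p k s as)
expand-entries p k s AllQ.[]           = AllQ.[]
expand-entries p k s (a≡±x AllQ.∷ as±) =
  sgn-≡± s a≡±x AllQ.∷ (sgn-≡± s (inj₁ refl) AllQ.∷ expand-entries p k (not s) as±)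

β-entries : ∀ p n k → AllQ (_≡± invPow p k) (β p n k)
β-entries p zero          k = AllQ.[]
β-entries p (suc zero)    k = inj₁ refl AllQ.∷ (inj₁ refl AllQ.∷ AllQ.[])
β-entries p (suc (suc n)) k = expand-entries p k true (β-entries p (suc n) k)

≡±-denominator : ∀ {a x} → a ≡± x → ℚ.denominatorℕ a ≡ ℚ.denominatorℕ x
≡±-denominator (inj₁ refl) = refl
≡±-denominator {x = x} (inj₂ refl) = cong ℤ.∣_∣ (ℚₚ.↧-neg x)

≡±-abs : ∀ {a x} → 0ℚ ℚ.≤ x → a ≡± x → ∣ a ∣ ≡ x
≡±-abs x≥0 (inj₁ refl) = ℚₚ.0≤p⇒∣p∣≡p x≥0
≡±-abs {x = x} x≥0 (inj₂ refl) = trans (ℚₚ.∣-p∣≡∣p∣ x) (ℚₚ.0≤p⇒∣p∣≡p x≥0)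

-p≤p : ∀ {p} → 0ℚ ℚ.≤ p → - p ℚ.≤ p
-p≤p p≥0 = ℚₚ.≤-trans (ℚₚ.neg-antimono-≤ p≥0) p≥0

≡±-bounded : ∀ {a x q} → 0ℚ ℚ.≤ x → x ℚ.< q → a ≡± x → - q ℚ.< a × a ℚ.< q
≡±-bounded x≥0 x<q (inj₁ refl) = ℚₚ.<-≤-trans (ℚₚ.neg-antimono-< x<q) (-p≤p x≥0) , x<q
≡±-bounded x≥0 x<q (inj₂ refl) = ℚₚ.neg-antimono-< x<q , ℚₚ.≤-<-trans (-p≤p x≥0) x<q

module _ (p : ℕ) (3≤p : 3 ≤ p) where
  instance
    p≢0 : NonZero p
    p≢0 = ℕ.>-nonZero (ℕₚ.≤-trans (s≤s z≤n) 3≤p)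

  3≤p^suc : ∀ k → 3 ≤ p ℕ.^ suc k
  3≤p^suc k = ℕₚ.≤-trans 3≤p (ℕₚ.m≤m*n p (p ℕ.^ k) {{ℕₚ.m^n≢0 p k}})

  invPow≤⅓ : ∀ k → invPow p (suc k) ℚ.≤ ⅓
  invPow≤⅓ k = x*n≡1⇒x≤⅓ (ℚₚ.<⇒≤ (invPow-pos p (suc k))) (invPow-*-pow p (suc k)) (3≤p^suc k)

  bounds-β : ∀ n k → Bounds (invPow p (suc k)) (convergents (β p (suc n) (suc k)))
  bounds-β zero    k = subst (Bounds x) (sym (convergents-pair x)) (bounds-base (invPow-pos p (suc k)))
    where x = invPow p (suc k)
  bounds-β (suc n) k = bounds-step x>0 (≤⅓⇒5x²≤1 (ℚₚ.<⇒≤ x>0) (invPow≤⅓ k)) (β-doubling p n (suc k))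
    (subst (λ y → Bounds y (convergents (β p (suc n) (suc k ℕ.+ suc k)))) (invPow-+ p (suc k) (suc k))
      (bounds-β n (k ℕ.+ suc k)))
    where x>0 = invPow-pos p (suc k)

  p∤1 : ¬ p ∣ 1
  p∤1 p∣1 = ℕₚ.<⇒≢ (ℕₚ.≤-trans (s≤s (s≤s z≤n)) 3≤p) (sym (∣1⇒≡1 p∣1))

  ⅓<p/4 : ⅓ ℚ.< ℕ→ℚ p * (+ 1 / 4)
  ⅓<p/4 = ℚₚ.<-≤-trans (toWitness {a? = ⅓ ℚₚ.<? ℕ→ℚ 3 * (+ 1 / 4)} tt)
    (ℚₚ.*-monoʳ-≤-nonNeg (+ 1 / 4) (ℕ→ℚ-mono-≤ 3≤p))

  p/4≤p/2 : ℕ→ℚ p * (+ 1 / 4) ℚ.≤ ℕ→ℚ p * (+ 1 / 2)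
  p/4≤p/2 = ℚₚ.*-monoˡ-≤-nonNeg (ℕ→ℚ p) {{ℚ.nonNegative (ℕ→ℚ-nonNeg p)}} (ℚₚ.≤ᵇ⇒≤ tt)

  module _ (k : ℕ) where
    private
      x = invPow p (suc k)
      x≥0 : 0ℚ ℚ.≤ x
      x≥0 = ℚₚ.<⇒≤ (invPow-pos p (suc k))
      x≤⅓ : x ℚ.≤ ⅓
      x≤⅓ = invPow≤⅓ k

    entry-InY : ∀ {a} → a ≡± x → InY p a
    entry-InY a≡±x = (suc k , trans (≡±-denominator a≡±x) (invPow-denominator p (suc k)))
                   , ≡±-bounded x≥0 (ℚₚ.<-≤-trans (ℚₚ.≤-<-trans x≤⅓ ⅓<p/4) p/4≤p/2) a≡±x

    entry-PAbsGt1 : ∀ {a} → a ≡± x → PAbsGt1 p a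
    entry-PAbsGt1 a≡±x =
      subst (p ∣_) (sym (trans (≡±-denominator a≡±x) (invPow-denominator p (suc k)))) (m∣m*n (p ℕ.^ k))

    entry-small : ∀ {a} → a ≡± x → ∣ a ∣ ℚ.< ℕ→ℚ p * (+ 1 / 4)
    entry-small a≡±x = subst (ℚ._< ℕ→ℚ p * (+ 1 / 4)) (sym (≡±-abs x≥0 a≡±x))
      (ℚₚ.≤-<-trans x≤⅓ ⅓<p/4)

    condB-bound : ∀ {C} → Bounds x C →
      ℕ→ℚ 4 * ∣ Convergents.A₋ C ∣ ℚ.< ℕ→ℚ p * ∣ Convergents.A C ∣
    condB-bound {C} I = begin-strict
      ℕ→ℚ 4 * ∣ A₋ ∣    ≤⟨ ℚₚ.*-monoˡ-≤-nonNeg (ℕ→ℚ 4) {{ℚ.nonNegative (ℕ→ℚ-nonNeg 4)}}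
                            (ℚₚ.≤-trans (∣A₋∣≤x x≥0 (≤⅓⇒5x²≤1 x≥0 x≤⅓) I) x≤⅓) ⟩
      ℕ→ℚ 4 * ⅓         <⟨ toWitness {a? = ℕ→ℚ 4 * ⅓ ℚₚ.<? ℕ→ℚ 3} tt ⟩
      ℕ→ℚ 3             ≤⟨ ℕ→ℚ-mono-≤ 3≤p ⟩
      ℕ→ℚ p             ≡⟨ ℚₚ.*-identityʳ (ℕ→ℚ p) ⟨
      ℕ→ℚ p * 1ℚ        ≤⟨ ℚₚ.*-monoˡ-≤-nonNeg (ℕ→ℚ p) {{ℚ.nonNegative (ℕ→ℚ-nonNeg p)}} (Bounds.1≤A I) ⟩
      ℕ→ℚ p * A         ≡⟨ cong (ℕ→ℚ p *_) (ℚₚ.0≤p⇒∣p∣≡p (ℚₚ.≤-trans (ℚₚ.≤ᵇ⇒≤ tt) (Bounds.1≤A I))) ⟨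
      ℕ→ℚ p * ∣ A ∣     ∎
      where
      open ℚₚ.≤-Reasoning
      open Convergents C

    nice-if : ∀ as → AllQ (_≡± x) as → Bounds x (convergents as) → PowerForm p (suc k) (convergents as) →
      IsNiceBCF p as × IsTilde p (proj₂ (lastB as)) (+ 1)
    nice-if []        _                  I _ = ⊥-elim (ℚₚ.<-irrefl refl (Bounds.B>0 I))
    nice-if (a₀ ∷ as) (a₀≡±x AllQ.∷ as±) I F =
      ((entry-InY a₀≡±x , later-entries as±) , (entry-PAbsGt1 a₀≡±x , entry-small a₀≡±x) , condB , condC) , tildeB
      where
      module F = PowerForm F
      later-entries : ∀ {bs} → AllQ (_≡± x) bs → AllQ (λ a → InY p a × PAbsGt1 p a) bs
      later-entries AllQ.[]           = AllQ.[]
      later-entries (b≡±x AllQ.∷ bs±) = (entry-InY b≡±x , entry-PAbsGt1 b≡±x) AllQ.∷ later-entries bs±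
      condB : CondB p (a₀ ∷ as)
      condB = subst (λ A → proj₁ A ≢ 0ℚ × ℕ→ℚ 4 * ∣ proj₁ A ∣ ℚ.< ℕ→ℚ p * ∣ proj₂ A ∣)
        (sym (lastA≡convA a₀ as))
        (Bounds.A₋≢0 I , condB-bound I)
      tildeA : IsTilde p (proj₂ (lastA (a₀ ∷ as))) (+ F.N)
      tildeA = subst (λ A → IsTilde p A (+ F.N)) (sym (trans (cong proj₂ (lastA≡convA a₀ as)) F.A≡))
        (invPow-tilde p (F.e ℕ.+ suc k) F.N F.p∤N)
      tildeB : IsTilde p (proj₂ (lastB (a₀ ∷ as))) (+ 1)
      tildeB = subst (λ B → IsTilde p B (+ 1))
        (sym (trans (cong proj₂ (lastB≡convB a₀ as)) (trans F.B≡ (sym (ℚₚ.*-identityˡ _)))))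
        (invPow-tilde p F.e 1 p∤1)
      condC : CondC p (a₀ ∷ as)
      condC = + F.N , + 1 , tildeA , tildeB , + 1 , ∣-refl , ∣-refl , 0 , ℤ.∣ + F.N ℤ.* + F.N ∣ ∣0

  β-nice : ∀ n k → IsNiceBCF p (β p (suc n) (suc k)) × IsTilde p (proj₂ (lastB (β p (suc n) (suc k)))) (+ 1)
  β-nice n k = nice-if k (β p (suc n) (suc k)) (β-entries p (suc n) (suc k)) (bounds-β n k) (powerForm-β p p∤1 n k)

proposition5p17 : (p : ℕ) → Prime p → p > 2 → (n k : ℕ) → 1 ≤ n → 1 ≤ k →
    IsNiceBCF p (β p n k) × IsTilde p (proj₂ (lastB (β p n k))) (+ 1)
proposition5p17 p _ 3≤p (suc n) (suc k) _ _ = β-nice p 3≤p n k
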